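{- For every $n\ge 2$ and every Dyck $n$-path $P$, $Y(F(P))=X(P)$, where for a Dyck path $T$, $X(T)$ is the number of occurrences of the subpath $DUD$ in $T$, and $Y(T)$ is the number of occurrences of the subpath $DUDU$ in $T$, plus the number of occurrences of subpaths of the form $UUP^{+}DD$ with $P^{+}$ a nonempty Dyck path, plus $1$ if $T$ ends with $UD$ (and plus $0$ otherwise).
   Context: Dyck paths are words in $U$ (upstep) and $D$ (downstep) with equally many of each such that every prefix has at least as many $U$'s as $D$'s; size = number of $U$'s; $\epsilon$ = empty path; powers denote repetition; a subpath is a block of consecutive steps, and occurrences are counted by starting position. A nonempty Dyck path is primitive if no nonempty proper prefix is a Dyck path; every nonempty Dyck path is uniquely a concatenation of primitive ones (its components). The bijection $F$ on Dyck paths: $F(\epsilon)=\epsilon$; if $P$ has components $P_1,\dots,P_r$, $r\ge2$, then $F(P)=F(P_1)\cdots F(P_r)$; a primitive $P$ is uniquely $P=UQ(UD)^iD$ with $i\ge0$ and $Q$ a Dyck path that is empty or ends with $DD$, and $F(P)=U^{i+1}F(R)UDD^{i+1}$ if $Q$ is primitive, $Q=URD$, while $F(P)=U^{i+1}F(Q)D^{i+1}$ if $Q$ is not primitive (including $Q=\epsilon$). -}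

module Defs where

open import Data.Nat using (ℕ; zero; suc; _+_)
open import Data.Bool using (Bool; true; false; if_then_else_; _∧_; _∨_)
open import Data.List using (List; []; _∷_; _++_; length; replicate; reverse; tails; inits)
open import Data.Product using (_×_; _,_)

data Step : Set where
  U D : Step

Word : Set
Word = List Step

_=ˢ_ : Step → Step → Bool
U =ˢ U = true
D =ˢ D = true
_ =ˢ _ = false

prefix? : Word → Word → Bool
prefix? []       _        = true
prefix? (_ ∷ _)  []       = false
prefix? (a ∷ p)  (b ∷ w)  = (a =ˢ b) ∧ prefix? p w

dyck? : ℕ → Word → Bool
dyck? zero    []      = true
dyck? (suc _) []      = false
dyck? h       (U ∷ w) = dyck? (suc h) w
dyck? zero    (D ∷ w) = false
dyck? (suc h) (D ∷ w) = dyck? h w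

isDyck : Word → Bool
isDyck = dyck? 0

countU : Word → ℕ
countU []      = 0
countU (U ∷ w) = suc (countU w)
countU (D ∷ w) = countU w

-- Dyck paths, represented by their unique decomposition:
-- a Dyck path is the list of its components (primitive Dyck paths),
-- and a primitive Dyck path is  U A D  with  A  a Dyck path.
-- (This is the standard bijection between Dyck paths and plane forests.)

data Prim : Set where
  node : List Prim → Prim

DyckPath : Set
DyckPath = List Prim

mutual
  wordP : Prim → Word
  wordP (node as) = U ∷ word as ++ D ∷ []

  word : DyckPath → Word
  word []       = []
  word (p ∷ ps) = wordP p ++ word ps

size : DyckPath → ℕ
size P = countU (word P)

-- For a primitive path  U A D  with components of A = c₁ … cₖ, the unique
-- decomposition  A = Q (UD)^i  with Q empty or ending in DD is:
-- i = number of trailing components equal to UD (= node []),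
-- Q = the remaining components (whose last one, if any, is not UD,
-- hence ends with DD).  Q is primitive iff it is a single component
-- U R D, which then is not UD, i.e. R nonempty.

isUD : Prim → Bool
isUD (node []) = true
isUD (node (_ ∷ _)) = false

allUD : List Prim → Bool
allUD []       = true
allUD (c ∷ cs) = isUD c ∧ allUD cs

trailingUD : List Prim → ℕ
trailingUD []       = 0
trailingUD (c ∷ cs) = if allUD (c ∷ cs) then length (c ∷ cs) else trailingUD cs

mutual
  F : DyckPath → Word
  F []       = []
  F (p ∷ ps) = Fprim p ++ F ps

  Fprim : Prim → Word
  Fprim (node cs) = Fbody cs

  -- F (U Q (UD)^i D), given the components  cs  of  Q (UD)^i
  Fbody : List Prim → Word
  -- Q primitive: Q = U R D with R = r ∷ rs, and the rest is (UD)^i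
  Fbody (node (r ∷ rs) ∷ ts) =
    if allUD ts
    then replicate (suc (length ts)) U ++ F (r ∷ rs) ++ U ∷ D ∷ replicate (suc (length ts)) D
    else replicate (suc (trailingUD (node (r ∷ rs) ∷ ts))) U
                  ++ FQ (node (r ∷ rs) ∷ ts)
                  ++ replicate (suc (trailingUD (node (r ∷ rs) ∷ ts))) D
  -- Q not primitive (possibly empty)
  Fbody cs = replicate (suc (trailingUD cs)) U ++ FQ cs ++ replicate (suc (trailingUD cs)) D

  -- F(Q), where Q = the components of cs with the trailing UD's removed
  FQ : List Prim → Word
  FQ []       = []
  FQ (c ∷ cs) = if allUD (c ∷ cs) then [] else Fprim c ++ FQ cs

count : {A : Set} → (A → Bool) → List A → ℕ
count f []       = 0
count f (x ∷ xs) = (if f x then 1 else 0) + count f xs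

anyB : {A : Set} → (A → Bool) → List A → Bool
anyB f []       = false
anyB f (x ∷ xs) = f x ∨ anyB f xs

countOcc : Word → Word → ℕ
countOcc p w = count (prefix? p) (tails w)

isUUPDD : Word → Bool
isUUPDD (U ∷ U ∷ w) with reverse w
... | D ∷ D ∷ v@(_ ∷ _) = isDyck (reverse v)
... | _ = false
isUUPDD _ = false

startsUUPDD : Word → Bool
startsUUPDD s = anyB isUUPDD (inits s)

endsWithUD : Word → Bool
endsWithUD w = prefix? (D ∷ U ∷ []) (reverse w)

X : Word → ℕ
X T = countOcc (D ∷ U ∷ D ∷ []) T

Y : Word → ℕ
Y T = countOcc (D ∷ U ∷ D ∷ U ∷ []) T
    + count startsUUPDD (tails T)
    + (if endsWithUD T then 1 else 0)

-- Read a Dyck path as a plane forest, a component U A D being a vertex with subforest A.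
-- Then the DUD's are the components followed by a leaf sibling, the DUDU's those followed
-- by a leaf that is not the last sibling, and the UUP⁺DD's the vertices whose only child is
-- not a leaf. F turns a component U Q (UD)ⁱ D into a chain of i single-child vertices over
-- the image of Q (with a leaf appended when Q is primitive): the chain contributes i
-- UUP⁺DD's, matching the DUD's in front of the i trailing UD's, and induction on the forest
-- matches the rest. What remains is the final-UD term of Y against a last leaf that is not
-- the first component; these agree unless P = UD, which n ≥ 2 excludes.
module Submission where

open import Defs
open import Data.Nat using (ℕ; zero; suc; _+_; _≤_; s≤s; pred)
open import Data.Nat.Properties using (+-assoc; +-comm; +-identityʳ)
open import Data.Nat.Solver using (module +-*-Solver)
open import Data.Bool using (Bool; true; false; if_then_else_; _∧_; _∨_; not)
open import Data.Bool.Properties using (∨-zeroʳ; ∧-identityʳ; if-float)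
open import Data.List using (List; []; _∷_; _++_; length; replicate; reverse; tails; inits; map)
open import Data.List.Properties
  using (++-assoc; ++-identityʳ; reverse-++; reverse-injective; reverse-involutive; reverse-selfInverse; ∷-injectiveʳ)
open import Data.List.Relation.Unary.All using (All; []; _∷_)
open import Data.Product using (_×_; _,_; ∃-syntax; map₁)
open import Data.Sum using (_⊎_; inj₁; inj₂)
open import Data.Empty using (⊥-elim)
open import Function using (_∘_)
open import Relation.Binary.PropositionalEquality
open +-*-Solver using (solve; _:+_; _:=_; con)
open ≡-Reasoning

⟦_⟧ : Bool → ℕ
⟦ b ⟧ = if b then 1 else 0

+-assoc₄ : ∀ a b c d → a + (b + (c + d)) ≡ a + b + c + d
+-assoc₄ a b c d = trans (sym (+-assoc a b (c + d))) (sym (+-assoc (a + b) c d))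

-- word P ++ v, built so that concatenation needs no reassociation
mutual
  wordP-onto : Prim → Word → Word
  wordP-onto (node cs) v = U ∷ word-onto cs (D ∷ v)

  word-onto : DyckPath → Word → Word
  word-onto []       v = v
  word-onto (p ∷ ps) v = wordP-onto p (word-onto ps v)

mutual
  wordP-onto-≡ : ∀ p v → wordP-onto p v ≡ wordP p ++ v
  wordP-onto-≡ (node cs) v =
    cong (U ∷_) (trans (word-onto-≡ cs (D ∷ v)) (sym (++-assoc (word cs) (D ∷ []) v)))

  word-onto-≡ : ∀ P v → word-onto P v ≡ word P ++ v
  word-onto-≡ []       v = refl
  word-onto-≡ (p ∷ ps) v = begin
    wordP-onto p (word-onto ps v)  ≡⟨ cong (wordP-onto p) (word-onto-≡ ps v) ⟩
    wordP-onto p (word ps ++ v)    ≡⟨ wordP-onto-≡ p (word ps ++ v) ⟩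
    wordP p ++ (word ps ++ v)      ≡⟨ ++-assoc (wordP p) (word ps) v ⟨
    (wordP p ++ word ps) ++ v      ∎

word≡word-onto-[] : ∀ P → word P ≡ word-onto P []
word≡word-onto-[] P = sym (trans (word-onto-≡ P []) (++-identityʳ (word P)))

word-++ : ∀ P Q → word (P ++ Q) ≡ word P ++ word Q
word-++ []       Q = refl
word-++ (p ∷ P) Q = trans (cong (wordP p ++_) (word-++ P Q)) (sym (++-assoc (wordP p) (word P) (word Q)))

leaf : Prim
leaf = node []

startsWithLeaf : DyckPath → Bool
startsWithLeaf []      = false
startsWithLeaf (p ∷ _) = isUD p

startsWithNonfinalLeaf : DyckPath → Bool
startsWithNonfinalLeaf (p ∷ _ ∷ _) = isUD p
startsWithNonfinalLeaf _           = false

singleNonLeaf : DyckPath → Bool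
singleNonLeaf (p ∷ []) = not (isUD p)
singleNonLeaf _        = false

endsWithLeaf : DyckPath → Bool
endsWithLeaf []           = false
endsWithLeaf (p ∷ [])     = isUD p
endsWithLeaf (_ ∷ p ∷ ps) = endsWithLeaf (p ∷ ps)

endsWithNonfirstLeaf : DyckPath → Bool
endsWithNonfirstLeaf (_ ∷ ps@(_ ∷ _)) = endsWithLeaf ps
endsWithNonfirstLeaf _                = false

mutual
  #DUDᵖ : Prim → ℕ
  #DUDᵖ (node cs) = #DUD cs

  #DUD : DyckPath → ℕ
  #DUD []       = 0
  #DUD (p ∷ ps) = #DUDᵖ p + ⟦ startsWithLeaf ps ⟧ + #DUD ps

#DUDU : DyckPath → ℕ
#DUDU []             = 0
#DUDU (node cs ∷ ps) = #DUDU cs + ⟦ startsWithNonfinalLeaf ps ⟧ + #DUDU ps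

#UUPDD : DyckPath → ℕ
#UUPDD []             = 0
#UUPDD (node cs ∷ ps) = ⟦ singleNonLeaf cs ⟧ + #UUPDD cs + #UUPDD ps

mutual
  #DUDU+UUPDDᵖ : Prim → ℕ
  #DUDU+UUPDDᵖ (node cs) = ⟦ singleNonLeaf cs ⟧ + #DUDU+UUPDD cs

  #DUDU+UUPDD : DyckPath → ℕ
  #DUDU+UUPDD []       = 0
  #DUDU+UUPDD (p ∷ ps) = #DUDU+UUPDDᵖ p + ⟦ startsWithNonfinalLeaf ps ⟧ + #DUDU+UUPDD ps

#DUDU+#UUPDD : ∀ P → #DUDU P + #UUPDD P ≡ #DUDU+UUPDD P
#DUDU+#UUPDD []             = refl
#DUDU+#UUPDD (node cs ∷ ps) rewrite sym (#DUDU+#UUPDD cs) | sym (#DUDU+#UUPDD ps) =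
  solve 6 (λ a l c d s f → (a :+ l :+ c) :+ (s :+ d :+ f) := s :+ (a :+ d) :+ l :+ (c :+ f)) refl
    (#DUDU cs) ⟦ startsWithNonfinalLeaf ps ⟧ (#DUDU ps) (#UUPDD cs) ⟦ singleNonLeaf cs ⟧ (#UUPDD ps)

-- Continuations over whose left boundary no DUD or DUDU can occur
NoLeadingU : Word → Set
NoLeadingU v = prefix? (U ∷ []) v ≡ false

prefix?-U∷ : ∀ p v → NoLeadingU v → prefix? (U ∷ p) v ≡ false
prefix?-U∷ p []      _ = refl
prefix?-U∷ p (D ∷ _) _ = refl
prefix?-U∷ p (U ∷ _) ()

prefix?-UD-word-onto : ∀ ps v → NoLeadingU v →
                       prefix? (U ∷ D ∷ []) (word-onto ps v) ≡ startsWithLeaf ps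
prefix?-UD-word-onto []                      v noU = prefix?-U∷ (D ∷ []) v noU
prefix?-UD-word-onto (node []           ∷ _) _ _   = refl
prefix?-UD-word-onto (node (node _ ∷ _) ∷ _) _ _   = refl

prefix?-UDU-word-onto : ∀ ps v → NoLeadingU v →
                        prefix? (U ∷ D ∷ U ∷ []) (word-onto ps v) ≡ startsWithNonfinalLeaf ps
prefix?-UDU-word-onto []                          v noU = prefix?-U∷ (D ∷ U ∷ []) v noU
prefix?-UDU-word-onto (node [] ∷ [])              _ noU = noU
prefix?-UDU-word-onto (node [] ∷ node _ ∷ _)      _ _   = refl
prefix?-UDU-word-onto (node (node _ ∷ _) ∷ [])    _ _   = refl
prefix?-UDU-word-onto (node (node _ ∷ _) ∷ _ ∷ _) _ _   = refl

DUD DUDU : Word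
DUD  = D ∷ U ∷ D ∷ []
DUDU = D ∷ U ∷ D ∷ U ∷ []

countOcc-DUD-word-onto : ∀ P v → NoLeadingU v → countOcc DUD (word-onto P v) ≡ #DUD P + countOcc DUD v
countOcc-DUD-word-onto []             _ noU = refl
countOcc-DUD-word-onto (node cs ∷ ps) v noU = begin
    countOcc DUD (word-onto cs (D ∷ y))
  ≡⟨ countOcc-DUD-word-onto cs (D ∷ y) refl ⟩
    #DUD cs + (⟦ prefix? (U ∷ D ∷ []) y ⟧ + countOcc DUD y)
  ≡⟨ cong₂ (λ b n → #DUD cs + (⟦ b ⟧ + n)) (prefix?-UD-word-onto ps v noU) (countOcc-DUD-word-onto ps v noU) ⟩
    #DUD cs + (⟦ startsWithLeaf ps ⟧ + (#DUD ps + countOcc DUD v))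
  ≡⟨ +-assoc₄ (#DUD cs) _ (#DUD ps) (countOcc DUD v) ⟩
    #DUD cs + ⟦ startsWithLeaf ps ⟧ + #DUD ps + countOcc DUD v
  ∎ where y = word-onto ps v

countOcc-DUDU-word-onto : ∀ P v → NoLeadingU v → countOcc DUDU (word-onto P v) ≡ #DUDU P + countOcc DUDU v
countOcc-DUDU-word-onto []             _ noU = refl
countOcc-DUDU-word-onto (node cs ∷ ps) v noU = begin
    countOcc DUDU (word-onto cs (D ∷ y))
  ≡⟨ countOcc-DUDU-word-onto cs (D ∷ y) refl ⟩
    #DUDU cs + (⟦ prefix? (U ∷ D ∷ U ∷ []) y ⟧ + countOcc DUDU y)
  ≡⟨ cong₂ (λ b n → #DUDU cs + (⟦ b ⟧ + n)) (prefix?-UDU-word-onto ps v noU) (countOcc-DUDU-word-onto ps v noU) ⟩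
    #DUDU cs + (⟦ startsWithNonfinalLeaf ps ⟧ + (#DUDU ps + countOcc DUDU v))
  ≡⟨ +-assoc₄ (#DUDU cs) _ (#DUDU ps) (countOcc DUDU v) ⟩
    #DUDU cs + ⟦ startsWithNonfinalLeaf ps ⟧ + #DUDU ps + countOcc DUDU v
  ∎ where y = word-onto ps v

X-word : ∀ P → X (word P) ≡ #DUD P
X-word P = begin
  countOcc DUD (word P)          ≡⟨ cong (countOcc DUD) (word≡word-onto-[] P) ⟩
  countOcc DUD (word-onto P [])  ≡⟨ countOcc-DUD-word-onto P [] refl ⟩
  #DUD P + 0                     ≡⟨ +-identityʳ _ ⟩
  #DUD P                         ∎

countOcc-DUDU-word : ∀ P → countOcc DUDU (word P) ≡ #DUDU P
countOcc-DUDU-word P = begin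
  countOcc DUDU (word P)          ≡⟨ cong (countOcc DUDU) (word≡word-onto-[] P) ⟩
  countOcc DUDU (word-onto P [])  ≡⟨ countOcc-DUDU-word-onto P [] refl ⟩
  #DUDU P + 0                     ≡⟨ +-identityʳ _ ⟩
  #DUDU P                         ∎

anyB-map : ∀ {A B : Set} (f : B → Bool) (g : A → B) xs → anyB f (map g xs) ≡ anyB (f ∘ g) xs
anyB-map f g []       = refl
anyB-map f g (x ∷ xs) = cong (f (g x) ∨_) (anyB-map f g xs)

anyB-inits⁺ : ∀ {A : Set} (f : List A → Bool) s r → f s ≡ true → anyB f (inits (s ++ r)) ≡ true
anyB-inits⁺ f []      r fs rewrite fs = refl
anyB-inits⁺ f (x ∷ s) r fs = begin
  f [] ∨ anyB f (map (x ∷_) (inits (s ++ r)))  ≡⟨ cong (f [] ∨_) (anyB-map f (x ∷_) (inits (s ++ r))) ⟩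
  f [] ∨ anyB (f ∘ (x ∷_)) (inits (s ++ r))    ≡⟨ cong (f [] ∨_) (anyB-inits⁺ (f ∘ (x ∷_)) s r fs) ⟩
  f [] ∨ true                                  ≡⟨ ∨-zeroʳ (f []) ⟩
  true                                         ∎

∨-true⁻ : ∀ a {b} → a ∨ b ≡ true → a ≡ true ⊎ b ≡ true
∨-true⁻ true  _ = inj₁ refl
∨-true⁻ false e = inj₂ e

anyB-inits⁻ : ∀ {A : Set} (f : List A → Bool) t → anyB f (inits t) ≡ true →
              ∃[ s ] ∃[ r ] t ≡ s ++ r × f s ≡ true
anyB-inits⁻ f t any with ∨-true⁻ (f []) any
... | inj₁ f[] = [] , t , refl , f[]
anyB-inits⁻ f (x ∷ t) any | inj₂ rest
  with anyB-inits⁻ (f ∘ (x ∷_)) t (trans (sym (anyB-map f (x ∷_) (inits t))) rest)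
... | s , r , refl , fs = x ∷ s , r , refl , fs

-- r is the reversal of P⁺ D D, the form in which isUUPDD inspects the tail after U U
isPDDʳ : Word → Bool
isPDDʳ (D ∷ D ∷ v@(_ ∷ _)) = isDyck (reverse v)
isPDDʳ _                   = false

isUUPDD-UU : ∀ w → isUUPDD (U ∷ U ∷ w) ≡ isPDDʳ (reverse w)
isUUPDD-UU w with reverse w
... | D ∷ D ∷ _ ∷ _ = refl
... | []            = refl
... | U ∷ _         = refl
... | D ∷ []        = refl
... | D ∷ U ∷ _     = refl
... | D ∷ D ∷ []    = refl

isPDDʳ-DD : ∀ v → v ≢ [] → isPDDʳ (D ∷ D ∷ v) ≡ isDyck (reverse v)
isPDDʳ-DD []      v≢[] = ⊥-elim (v≢[] refl)
isPDDʳ-DD (_ ∷ _) _    = refl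

isPDDʳ⁻ : ∀ r → isPDDʳ r ≡ true → ∃[ v ] r ≡ D ∷ D ∷ v × v ≢ [] × isDyck (reverse v) ≡ true
isPDDʳ⁻ (D ∷ D ∷ v@(_ ∷ _)) dyck = v , refl , (λ ()) , dyck

reverse≢[] : ∀ {A : Set} (w : List A) → w ≢ [] → reverse w ≢ []
reverse≢[] w w≢[] e = w≢[] (reverse-injective {x = w} {y = []} e)

isUUPDD⁺ : ∀ w → w ≢ [] → isDyck w ≡ true → isUUPDD (U ∷ U ∷ w ++ D ∷ D ∷ []) ≡ true
isUUPDD⁺ w w≢[] dyck = begin
  isUUPDD (U ∷ U ∷ w ++ D ∷ D ∷ [])   ≡⟨ isUUPDD-UU (w ++ D ∷ D ∷ []) ⟩
  isPDDʳ (reverse (w ++ D ∷ D ∷ []))  ≡⟨ cong isPDDʳ (reverse-++ w (D ∷ D ∷ [])) ⟩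
  isPDDʳ (D ∷ D ∷ reverse w)          ≡⟨ isPDDʳ-DD (reverse w) (reverse≢[] w w≢[]) ⟩
  isDyck (reverse (reverse w))        ≡⟨ cong isDyck (reverse-involutive w) ⟩
  isDyck w                            ≡⟨ dyck ⟩
  true                                ∎

isUUPDD⁻ : ∀ s → isUUPDD s ≡ true → ∃[ w ] s ≡ U ∷ U ∷ w ++ D ∷ D ∷ [] × w ≢ [] × isDyck w ≡ true
isUUPDD⁻ (U ∷ U ∷ w) uu with isPDDʳ⁻ (reverse w) (trans (sym (isUUPDD-UU w)) uu)
... | v , rw≡DDv , v≢[] , dyck = reverse v , cong (λ z → U ∷ U ∷ z) w≡ , reverse≢[] v v≢[] , dyck
  where
    w≡ : w ≡ reverse v ++ D ∷ D ∷ []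
    w≡ = trans (sym (reverse-selfInverse rw≡DDv)) (reverse-++ (D ∷ D ∷ []) v)

mutual
  dyck?-wordP-onto : ∀ h p v → dyck? h (wordP-onto p v) ≡ dyck? h v
  dyck?-wordP-onto zero    (node cs) v = dyck?-word-onto 1 cs (D ∷ v)
  dyck?-wordP-onto (suc h) (node cs) v = dyck?-word-onto (suc (suc h)) cs (D ∷ v)

  dyck?-word-onto : ∀ h P v → dyck? h (word-onto P v) ≡ dyck? h v
  dyck?-word-onto h []       v = refl
  dyck?-word-onto h (p ∷ ps) v = trans (dyck?-wordP-onto h p (word-onto ps v)) (dyck?-word-onto h ps v)

isDyck-word : ∀ P → isDyck (word P) ≡ true
isDyck-word P = trans (cong isDyck (word≡word-onto-[] P)) (dyck?-word-onto 0 P [])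

D-after-dyck-unique : ∀ h w w' {a a'} → dyck? h w ≡ true → dyck? h w' ≡ true →
                      w ++ D ∷ a ≡ w' ++ D ∷ a' → w ≡ w' × a ≡ a'
D-after-dyck-unique h       []      []       _  _   eq = refl , ∷-injectiveʳ eq
D-after-dyck-unique zero    (U ∷ w) (U ∷ w') dw dw' eq =
  map₁ (cong (U ∷_)) (D-after-dyck-unique 1 w w' dw dw' (∷-injectiveʳ eq))
D-after-dyck-unique (suc h) (U ∷ w) (U ∷ w') dw dw' eq =
  map₁ (cong (U ∷_)) (D-after-dyck-unique (suc (suc h)) w w' dw dw' (∷-injectiveʳ eq))
D-after-dyck-unique (suc h) (D ∷ w) (D ∷ w') dw dw' eq =
  map₁ (cong (D ∷_)) (D-after-dyck-unique h w w' dw dw' (∷-injectiveʳ eq))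
D-after-dyck-unique (suc h) []      _        () _   _
D-after-dyck-unique (suc h) _       []       _  ()  _
D-after-dyck-unique zero    (D ∷ _) _        () _   _
D-after-dyck-unique zero    _       (D ∷ _)  _  ()  _
D-after-dyck-unique _       []      (U ∷ _)  _  _   ()
D-after-dyck-unique _       (U ∷ _) []       _  _   ()
D-after-dyck-unique _       (U ∷ _) (D ∷ _)  _  _   ()
D-after-dyck-unique _       (D ∷ _) (U ∷ _)  _  _   ()

startsUUPDD-D : ∀ w → startsUUPDD (D ∷ w) ≡ false
startsUUPDD-D w = noneStartsWithUU (inits w)
  where
    noneStartsWithUU : ∀ ss → anyB isUUPDD (map (D ∷_) ss) ≡ false
    noneStartsWithUU []       = refl
    noneStartsWithUU (_ ∷ ss) = noneStartsWithUU ss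

startsUUPDD⁺ : ∀ e ds x → startsUUPDD (U ∷ word-onto (node (node e ∷ ds) ∷ []) (D ∷ x)) ≡ true
startsUUPDD⁺ e ds x =
  trans (cong startsUUPDD path)
        (anyB-inits⁺ isUUPDD (U ∷ U ∷ w ++ D ∷ D ∷ []) x (isUUPDD⁺ w (λ ()) (isDyck-word (node e ∷ ds))))
  where
    w = word (node e ∷ ds)
    path : U ∷ word-onto (node (node e ∷ ds) ∷ []) (D ∷ x) ≡ (U ∷ U ∷ w ++ D ∷ D ∷ []) ++ x
    path = cong (λ z → U ∷ U ∷ z)
                (trans (word-onto-≡ (node e ∷ ds) (D ∷ D ∷ x)) (sym (++-assoc w (D ∷ D ∷ []) x)))

-- A UUP⁺DD starting at the U of U A D must end at its D, by uniqueness of the first return.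
startsUUPDD⁻ : ∀ cs x → startsUUPDD (U ∷ word-onto cs (D ∷ x)) ≡ true → singleNonLeaf cs ≡ true
startsUUPDD⁻ cs x st with anyB-inits⁻ isUUPDD (U ∷ word-onto cs (D ∷ x)) st
... | s , r , eq , uu with isUUPDD⁻ s uu
... | w , refl , w≢[] , dyck-w = single cs (∷-injectiveʳ eq)
  where
    single : ∀ cs → word-onto cs (D ∷ x) ≡ U ∷ (w ++ D ∷ D ∷ []) ++ r → singleNonLeaf cs ≡ true
    single (node ds ∷ rest) eq′
      with D-after-dyck-unique 0 (word ds) w (isDyck-word ds) dyck-w
             (trans (sym (word-onto-≡ ds _)) (trans (∷-injectiveʳ eq′) (++-assoc w (D ∷ D ∷ []) r)))
    single (node []      ∷ rest)         eq′ | ds≡w , _ = ⊥-elim (w≢[] (sym ds≡w))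
    single (node (_ ∷ _) ∷ [])           eq′ | _ , _    = refl
    single (node (_ ∷ _) ∷ node _ ∷ _)   eq′ | _ , ()

startsUUPDD-node : ∀ cs x → startsUUPDD (U ∷ word-onto cs (D ∷ x)) ≡ singleNonLeaf cs
startsUUPDD-node cs x with startsUUPDD (U ∷ word-onto cs (D ∷ x)) in st
... | true = sym (startsUUPDD⁻ cs x st)
startsUUPDD-node []                       x | false = refl
startsUUPDD-node (node [] ∷ [])           x | false = refl
startsUUPDD-node (node (node e ∷ ds) ∷ []) x | false = trans (sym st) (startsUUPDD⁺ e ds x)
startsUUPDD-node (_ ∷ _ ∷ _)              x | false = refl

count-startsUUPDD-word-onto : ∀ P v →
  count startsUUPDD (tails (word-onto P v)) ≡ #UUPDD P + count startsUUPDD (tails v)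
count-startsUUPDD-word-onto []             v = refl
count-startsUUPDD-word-onto (node cs ∷ ps) v = begin
    ⟦ startsUUPDD (U ∷ word-onto cs (D ∷ y)) ⟧ + count startsUUPDD (tails (word-onto cs (D ∷ y)))
  ≡⟨ cong₂ (λ b n → ⟦ b ⟧ + n) (startsUUPDD-node cs y) (count-startsUUPDD-word-onto cs (D ∷ y)) ⟩
    ⟦ singleNonLeaf cs ⟧ + (#UUPDD cs + (⟦ startsUUPDD (D ∷ y) ⟧ + count startsUUPDD (tails y)))
  ≡⟨ cong₂ (λ b n → ⟦ singleNonLeaf cs ⟧ + (#UUPDD cs + (⟦ b ⟧ + n)))
           (startsUUPDD-D y) (count-startsUUPDD-word-onto ps v) ⟩
    ⟦ singleNonLeaf cs ⟧ + (#UUPDD cs + (0 + (#UUPDD ps + count startsUUPDD (tails v))))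
  ≡⟨ +-assoc₄ ⟦ singleNonLeaf cs ⟧ (#UUPDD cs) (#UUPDD ps) (count startsUUPDD (tails v)) ⟩
    ⟦ singleNonLeaf cs ⟧ + #UUPDD cs + #UUPDD ps + count startsUUPDD (tails v)
  ∎ where y = word-onto ps v

count-startsUUPDD-word : ∀ P → count startsUUPDD (tails (word P)) ≡ #UUPDD P
count-startsUUPDD-word P = begin
  count startsUUPDD (tails (word P))          ≡⟨ cong (count startsUUPDD ∘ tails) (word≡word-onto-[] P) ⟩
  count startsUUPDD (tails (word-onto P []))  ≡⟨ count-startsUUPDD-word-onto P [] ⟩
  #UUPDD P + 0                                ≡⟨ +-identityʳ _ ⟩
  #UUPDD P                                    ∎

lastSteps : Bool → Word
lastSteps b = (if b then U else D) ∷ D ∷ []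

endsWithUD-lastSteps : ∀ w b → endsWithUD (w ++ lastSteps b) ≡ b
endsWithUD-lastSteps w true  rewrite reverse-++ w (lastSteps true)  = refl
endsWithUD-lastSteps w false rewrite reverse-++ w (lastSteps false) = refl

word-endsWith : ∀ p ps → ∃[ w ] word (p ∷ ps) ≡ w ++ lastSteps (endsWithLeaf (p ∷ ps))
word-endsWith (node [])       [] = [] , refl
word-endsWith (node (c ∷ cs)) [] with word-endsWith c cs
... | w , eq = U ∷ w ++ x ∷ [] , cong (U ∷_) (begin
      (word (c ∷ cs) ++ D ∷ []) ++ []  ≡⟨ ++-identityʳ _ ⟩
      word (c ∷ cs) ++ D ∷ []          ≡⟨ cong (_++ D ∷ []) eq ⟩
      (w ++ x ∷ D ∷ []) ++ D ∷ []      ≡⟨ ++-assoc w (x ∷ D ∷ []) (D ∷ []) ⟩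
      w ++ x ∷ D ∷ D ∷ []              ≡⟨ ++-assoc w (x ∷ []) (D ∷ D ∷ []) ⟨
      (w ++ x ∷ []) ++ D ∷ D ∷ []      ∎)
  where x = if endsWithLeaf (c ∷ cs) then U else D
word-endsWith p (q ∷ qs) with word-endsWith q qs
... | w , eq = wordP p ++ w ,
  trans (cong (wordP p ++_) eq) (sym (++-assoc (wordP p) w (lastSteps (endsWithLeaf (q ∷ qs)))))

endsWithUD-word : ∀ P → endsWithUD (word P) ≡ endsWithLeaf P
endsWithUD-word []       = refl
endsWithUD-word (p ∷ ps) with word-endsWith p ps
... | w , eq = trans (cong endsWithUD eq) (endsWithUD-lastSteps w (endsWithLeaf (p ∷ ps)))

Y-word : ∀ T → Y (word T) ≡ #DUDU+UUPDD T + ⟦ endsWithLeaf T ⟧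
Y-word T = begin
    countOcc DUDU (word T) + count startsUUPDD (tails (word T)) + ⟦ endsWithUD (word T) ⟧
  ≡⟨ cong₂ (λ n b → n + ⟦ b ⟧)
           (cong₂ _+_ (countOcc-DUDU-word T) (count-startsUUPDD-word T)) (endsWithUD-word T) ⟩
    #DUDU T + #UUPDD T + ⟦ endsWithLeaf T ⟧
  ≡⟨ cong (_+ ⟦ endsWithLeaf T ⟧) (#DUDU+#UUPDD T) ⟩
    #DUDU+UUPDD T + ⟦ endsWithLeaf T ⟧
  ∎

nest : ℕ → Prim → Prim
nest zero    p = p
nest (suc k) p = node (nest k p ∷ [])

mutual
  Fᵗ : DyckPath → DyckPath
  Fᵗ []       = []
  Fᵗ (p ∷ ps) = Fprimᵗ p ∷ Fᵗ ps

  Fprimᵗ : Prim → Prim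
  Fprimᵗ (node cs) = Fbodyᵗ cs

  Fbodyᵗ : List Prim → Prim
  Fbodyᵗ (node (r ∷ rs) ∷ ts) =
    if allUD ts
    then nest (length ts) (node (Fᵗ (r ∷ rs) ++ leaf ∷ []))
    else nest (trailingUD (node (r ∷ rs) ∷ ts)) (node (FQᵗ (node (r ∷ rs) ∷ ts)))
  Fbodyᵗ cs = nest (trailingUD cs) (node (FQᵗ cs))

  FQᵗ : List Prim → List Prim
  FQᵗ []       = []
  FQᵗ (c ∷ cs) = if allUD (c ∷ cs) then [] else Fprimᵗ c ∷ FQᵗ cs

replicate-snoc : ∀ {A : Set} k (x : A) → replicate k x ++ x ∷ [] ≡ x ∷ replicate k x
replicate-snoc zero    x = refl
replicate-snoc (suc k) x = cong (x ∷_) (replicate-snoc k x)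

wordP-nest : ∀ k cs → wordP (nest k (node cs)) ≡ replicate (suc k) U ++ word cs ++ replicate (suc k) D
wordP-nest zero    cs = refl
wordP-nest (suc k) cs = cong (U ∷_) (begin
    (wordP (nest k (node cs)) ++ []) ++ D ∷ []       ≡⟨ cong (_++ D ∷ []) (++-identityʳ _) ⟩
    wordP (nest k (node cs)) ++ D ∷ []               ≡⟨ cong (_++ D ∷ []) (wordP-nest k cs) ⟩
    (Uᵏ ++ word cs ++ Dᵏ) ++ D ∷ []                  ≡⟨ ++-assoc Uᵏ (word cs ++ Dᵏ) (D ∷ []) ⟩
    Uᵏ ++ (word cs ++ Dᵏ) ++ D ∷ []                  ≡⟨ cong (Uᵏ ++_) (++-assoc (word cs) Dᵏ (D ∷ [])) ⟩
    Uᵏ ++ word cs ++ Dᵏ ++ D ∷ []                    ≡⟨ cong (λ z → Uᵏ ++ word cs ++ z) (replicate-snoc (suc k) D) ⟩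
    Uᵏ ++ word cs ++ D ∷ Dᵏ                          ∎)
  where
    Uᵏ = replicate (suc k) U
    Dᵏ = replicate (suc k) D

wordP-nest-snocLeaf : ∀ k T →
  wordP (nest k (node (T ++ leaf ∷ []))) ≡ replicate (suc k) U ++ word T ++ U ∷ D ∷ replicate (suc k) D
wordP-nest-snocLeaf k T = begin
    wordP (nest k (node (T ++ leaf ∷ [])))     ≡⟨ wordP-nest k (T ++ leaf ∷ []) ⟩
    Uᵏ ++ word (T ++ leaf ∷ []) ++ Dᵏ          ≡⟨ cong (λ z → Uᵏ ++ z ++ Dᵏ) (word-++ T (leaf ∷ [])) ⟩
    Uᵏ ++ (word T ++ U ∷ D ∷ []) ++ Dᵏ         ≡⟨ cong (Uᵏ ++_) (++-assoc (word T) (U ∷ D ∷ []) Dᵏ) ⟩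
    Uᵏ ++ word T ++ U ∷ D ∷ Dᵏ                 ∎
  where
    Uᵏ = replicate (suc k) U
    Dᵏ = replicate (suc k) D

mutual
  word-Fᵗ : ∀ P → word (Fᵗ P) ≡ F P
  word-Fᵗ []       = refl
  word-Fᵗ (p ∷ ps) = cong₂ _++_ (wordP-Fprimᵗ p) (word-Fᵗ ps)

  wordP-Fprimᵗ : ∀ p → wordP (Fprimᵗ p) ≡ Fprim p
  wordP-Fprimᵗ (node cs) = wordP-Fbodyᵗ cs

  wordP-Fbodyᵗ : ∀ cs → wordP (Fbodyᵗ cs) ≡ Fbody cs
  wordP-Fbodyᵗ []                   = wordP-nest-FQᵗ []
  wordP-Fbodyᵗ (node []       ∷ ts) = wordP-nest-FQᵗ (node [] ∷ ts)
  wordP-Fbodyᵗ (node (r ∷ rs) ∷ ts) =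
    trans (if-float wordP (allUD ts))
          (cong₂ (if_then_else_ (allUD ts))
                 (trans (wordP-nest-snocLeaf (length ts) (Fᵗ (r ∷ rs)))
                        (cong (λ z → Uⁱ ++ z ++ U ∷ D ∷ Dⁱ) (word-Fᵗ (r ∷ rs))))
                 (wordP-nest-FQᵗ (node (r ∷ rs) ∷ ts)))
    where
      Uⁱ = replicate (suc (length ts)) U
      Dⁱ = replicate (suc (length ts)) D

  wordP-nest-FQᵗ : ∀ cs → wordP (nest (trailingUD cs) (node (FQᵗ cs))) ≡
                          replicate (suc (trailingUD cs)) U ++ FQ cs ++ replicate (suc (trailingUD cs)) D
  wordP-nest-FQᵗ cs =
    trans (wordP-nest (trailingUD cs) (FQᵗ cs))
          (cong (λ z → replicate (suc (trailingUD cs)) U ++ z ++ replicate (suc (trailingUD cs)) D) (word-FQᵗ cs))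

  word-FQᵗ : ∀ cs → word (FQᵗ cs) ≡ FQ cs
  word-FQᵗ []       = refl
  word-FQᵗ (c ∷ cs) with allUD (c ∷ cs)
  ... | true  = refl
  ... | false = cong₂ _++_ (wordP-Fprimᵗ c) (word-FQᵗ cs)

isUD-nest : ∀ k x xs → isUD (nest k (node (x ∷ xs))) ≡ false
isUD-nest zero    _ _ = refl
isUD-nest (suc k) _ _ = refl

isUD-Fprimᵗ : ∀ p → isUD (Fprimᵗ p) ≡ isUD p
isUD-Fprimᵗ (node []) = refl
isUD-Fprimᵗ (node (node [] ∷ ts)) with allUD ts
... | true  = refl
... | false = isUD-nest (trailingUD ts) (Fprimᵗ leaf) (FQᵗ ts)
isUD-Fprimᵗ (node (node (r ∷ rs) ∷ ts)) with allUD ts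
... | true  = isUD-nest (length ts) (Fprimᵗ r) (Fᵗ rs ++ leaf ∷ [])
... | false = isUD-nest (trailingUD ts) (Fprimᵗ (node (r ∷ rs))) (FQᵗ ts)

endsWithLeaf-Fᵗ : ∀ P → endsWithLeaf (Fᵗ P) ≡ endsWithLeaf P
endsWithLeaf-Fᵗ []           = refl
endsWithLeaf-Fᵗ (p ∷ [])     = isUD-Fprimᵗ p
endsWithLeaf-Fᵗ (_ ∷ q ∷ qs) = endsWithLeaf-Fᵗ (q ∷ qs)

endsWithNonfirstLeaf-Fᵗ : ∀ P → endsWithNonfirstLeaf (Fᵗ P) ≡ endsWithNonfirstLeaf P
endsWithNonfirstLeaf-Fᵗ []           = refl
endsWithNonfirstLeaf-Fᵗ (_ ∷ [])     = refl
endsWithNonfirstLeaf-Fᵗ (_ ∷ q ∷ qs) = endsWithLeaf-Fᵗ (q ∷ qs)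

startsWithNonfinalLeaf-Fᵗ : ∀ P → startsWithNonfinalLeaf (Fᵗ P) ≡ startsWithNonfinalLeaf P
startsWithNonfinalLeaf-Fᵗ []          = refl
startsWithNonfinalLeaf-Fᵗ (_ ∷ [])    = refl
startsWithNonfinalLeaf-Fᵗ (p ∷ _ ∷ _) = isUD-Fprimᵗ p

singleNonLeaf-Fᵗ : ∀ P → singleNonLeaf (Fᵗ P) ≡ singleNonLeaf P
singleNonLeaf-Fᵗ []          = refl
singleNonLeaf-Fᵗ (p ∷ [])    = cong not (isUD-Fprimᵗ p)
singleNonLeaf-Fᵗ (_ ∷ _ ∷ _) = refl

endsWithNonfirstLeaf⁻ : ∀ P → endsWithLeaf P ≡ false → endsWithNonfirstLeaf P ≡ false
endsWithNonfirstLeaf⁻ []          _ = refl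
endsWithNonfirstLeaf⁻ (_ ∷ [])    _ = refl
endsWithNonfirstLeaf⁻ (_ ∷ _ ∷ _) e = e

nonfinalLeaf-nonfirstLeaf-exchange : ∀ p ps →
  ⟦ startsWithNonfinalLeaf ps ⟧ + ⟦ endsWithNonfirstLeaf (p ∷ ps) ⟧ ≡
  ⟦ startsWithLeaf ps ⟧ + ⟦ endsWithNonfirstLeaf ps ⟧
nonfinalLeaf-nonfirstLeaf-exchange _ []          = refl
nonfinalLeaf-nonfirstLeaf-exchange _ (_ ∷ [])    = sym (+-identityʳ _)
nonfinalLeaf-nonfirstLeaf-exchange _ (_ ∷ _ ∷ _) = refl

YF≡Xᵖ : Prim → Set
YF≡Xᵖ p = #DUDU+UUPDDᵖ (Fprimᵗ p) ≡ #DUDᵖ p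

-- A DUD after a component is a DUDU there, except when its leaf is the last component.
YF≡X-forest : ∀ P → All YF≡Xᵖ P → #DUDU+UUPDD (Fᵗ P) + ⟦ endsWithNonfirstLeaf P ⟧ ≡ #DUD P
YF≡X-forest []       []         = refl
YF≡X-forest (p ∷ ps) (hp ∷ hps) = begin
    #DUDU+UUPDDᵖ (Fprimᵗ p) + ⟦ startsWithNonfinalLeaf (Fᵗ ps) ⟧ + y + ⟦ e ⟧
  ≡⟨ cong₂ (λ n b → n + ⟦ b ⟧ + y + ⟦ e ⟧) hp (startsWithNonfinalLeaf-Fᵗ ps) ⟩
    #DUDᵖ p + ⟦ startsWithNonfinalLeaf ps ⟧ + y + ⟦ e ⟧
  ≡⟨ solve 4 (λ a l z f → a :+ l :+ z :+ f := a :+ (l :+ f) :+ z) refl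
       (#DUDᵖ p) ⟦ startsWithNonfinalLeaf ps ⟧ y ⟦ e ⟧ ⟩
    #DUDᵖ p + (⟦ startsWithNonfinalLeaf ps ⟧ + ⟦ e ⟧) + y
  ≡⟨ cong (λ n → #DUDᵖ p + n + y) (nonfinalLeaf-nonfirstLeaf-exchange p ps) ⟩
    #DUDᵖ p + (⟦ startsWithLeaf ps ⟧ + ⟦ endsWithNonfirstLeaf ps ⟧) + y
  ≡⟨ solve 4 (λ a h g z → a :+ (h :+ g) :+ z := a :+ h :+ (z :+ g)) refl
       (#DUDᵖ p) ⟦ startsWithLeaf ps ⟧ ⟦ endsWithNonfirstLeaf ps ⟧ y ⟩
    #DUDᵖ p + ⟦ startsWithLeaf ps ⟧ + (y + ⟦ endsWithNonfirstLeaf ps ⟧)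
  ≡⟨ cong (#DUDᵖ p + ⟦ startsWithLeaf ps ⟧ +_) (YF≡X-forest ps hps) ⟩
    #DUDᵖ p + ⟦ startsWithLeaf ps ⟧ + #DUD ps
  ∎
  where
    y = #DUDU+UUPDD (Fᵗ ps)
    e = endsWithNonfirstLeaf (p ∷ ps)

Y-nest : ∀ k x xs → #DUDU+UUPDDᵖ (nest k (node (x ∷ xs))) ≡ k + #DUDU+UUPDDᵖ (node (x ∷ xs))
Y-nest zero    x xs = refl
Y-nest (suc k) x xs = begin
    ⟦ not (isUD (nest k q)) ⟧ + (#DUDU+UUPDDᵖ (nest k q) + 0 + 0)
  ≡⟨ cong₂ (λ b n → ⟦ not b ⟧ + (n + 0 + 0)) (isUD-nest k x xs) (Y-nest k x xs) ⟩
    1 + (k + #DUDU+UUPDDᵖ q + 0 + 0)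
  ≡⟨ cong suc (trans (+-identityʳ _) (+-identityʳ _)) ⟩
    suc k + #DUDU+UUPDDᵖ q
  ∎ where q = node (x ∷ xs)

Y-nest-leaf : ∀ k → #DUDU+UUPDDᵖ (nest k leaf) ≡ pred k
Y-nest-leaf zero          = refl
Y-nest-leaf (suc zero)    = refl
Y-nest-leaf (suc (suc k)) = cong suc (trans (+-identityʳ _) (trans (+-identityʳ _) (Y-nest-leaf (suc k))))

Y-snocLeaf : ∀ T → #DUDU+UUPDD (T ++ leaf ∷ []) ≡ #DUDU+UUPDD T + ⟦ endsWithNonfirstLeaf T ⟧
Y-snocLeaf []               = refl
Y-snocLeaf (q ∷ [])         = sym (+-identityʳ _)
Y-snocLeaf (q ∷ r ∷ [])     =
  solve 3 (λ a b c → a :+ b :+ (c :+ con 0 :+ con 0) := a :+ con 0 :+ (c :+ con 0 :+ con 0) :+ b) refl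
    (#DUDU+UUPDDᵖ q) ⟦ isUD r ⟧ (#DUDU+UUPDDᵖ r)
Y-snocLeaf (q ∷ r ∷ s ∷ ss) =
  trans (cong (#DUDU+UUPDDᵖ q + ⟦ isUD r ⟧ +_) (Y-snocLeaf (r ∷ s ∷ ss)))
        (sym (+-assoc (#DUDU+UUPDDᵖ q + ⟦ isUD r ⟧) (#DUDU+UUPDD (r ∷ s ∷ ss)) ⟦ endsWithLeaf (s ∷ ss) ⟧))

#DUD-leaves : ∀ i → #DUD (replicate i leaf) ≡ pred i
#DUD-leaves zero          = refl
#DUD-leaves (suc zero)    = refl
#DUD-leaves (suc (suc i)) = cong suc (#DUD-leaves (suc i))

leaves-count : ∀ i → ⟦ startsWithLeaf (replicate i leaf) ⟧ + #DUD (replicate i leaf) ≡ i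
leaves-count zero    = refl
leaves-count (suc i) = cong suc (leaves-count i)

allLeaves-count : ∀ ts → allUD ts ≡ true → ⟦ startsWithLeaf ts ⟧ + #DUD ts ≡ length ts
allLeaves-count []             _ = refl
allLeaves-count (node [] ∷ ts) e = cong suc (allLeaves-count ts e)

#DUD-++-leaves : ∀ q qs i → #DUD ((q ∷ qs) ++ replicate i leaf) ≡ #DUD (q ∷ qs) + i
#DUD-++-leaves q [] i = begin
    #DUDᵖ q + ⟦ startsWithLeaf (replicate i leaf) ⟧ + #DUD (replicate i leaf)
  ≡⟨ +-assoc (#DUDᵖ q) _ _ ⟩
    #DUDᵖ q + (⟦ startsWithLeaf (replicate i leaf) ⟧ + #DUD (replicate i leaf))
  ≡⟨ cong (#DUDᵖ q +_) (leaves-count i) ⟩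
    #DUDᵖ q + i
  ≡⟨ cong (_+ i) (trans (+-identityʳ _) (+-identityʳ _)) ⟨
    #DUDᵖ q + 0 + 0 + i
  ∎
#DUD-++-leaves q (r ∷ rs) i =
  trans (cong (#DUDᵖ q + ⟦ isUD r ⟧ +_) (#DUD-++-leaves r rs i)) (sym (+-assoc (#DUDᵖ q + ⟦ isUD r ⟧) (#DUD (r ∷ rs)) i))

-- The decomposition U Q (UD)ⁱ D of a component U cs D: Q = dropTrailingLeaves cs, i = trailingUD cs.
dropTrailingLeaves : List Prim → List Prim
dropTrailingLeaves []       = []
dropTrailingLeaves (c ∷ cs) = if allUD (c ∷ cs) then [] else c ∷ dropTrailingLeaves cs

FQᵗ≡Fᵗ-dropTrailingLeaves : ∀ cs → FQᵗ cs ≡ Fᵗ (dropTrailingLeaves cs)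
FQᵗ≡Fᵗ-dropTrailingLeaves []       = refl
FQᵗ≡Fᵗ-dropTrailingLeaves (c ∷ cs) with allUD (c ∷ cs)
... | true  = refl
... | false = cong (Fprimᵗ c ∷_) (FQᵗ≡Fᵗ-dropTrailingLeaves cs)

allUD⇒replicate : ∀ cs → allUD cs ≡ true → cs ≡ replicate (length cs) leaf
allUD⇒replicate []             _ = refl
allUD⇒replicate (node [] ∷ cs) e = cong (leaf ∷_) (allUD⇒replicate cs e)

dropTrailingLeaves-++ : ∀ cs → dropTrailingLeaves cs ++ replicate (trailingUD cs) leaf ≡ cs
dropTrailingLeaves-++ []       = refl
dropTrailingLeaves-++ (c ∷ cs) with allUD (c ∷ cs) in e
... | true  = sym (allUD⇒replicate (c ∷ cs) e)
... | false = cong (c ∷_) (dropTrailingLeaves-++ cs)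

All-dropTrailingLeaves : ∀ {Q : Prim → Set} cs → All Q cs → All Q (dropTrailingLeaves cs)
All-dropTrailingLeaves []       []         = []
All-dropTrailingLeaves (c ∷ cs) (qc ∷ qcs) with allUD (c ∷ cs)
... | true  = []
... | false = qc ∷ All-dropTrailingLeaves cs qcs

dropTrailingLeaves≡[]⇒allUD : ∀ cs → dropTrailingLeaves cs ≡ [] → allUD cs ≡ true
dropTrailingLeaves≡[]⇒allUD []       _   = refl
dropTrailingLeaves≡[]⇒allUD (c ∷ cs) d≡[] with allUD (c ∷ cs)
... | true = refl
dropTrailingLeaves≡[]⇒allUD (c ∷ cs) () | false

endsWithLeaf-dropTrailingLeaves : ∀ cs → endsWithLeaf (dropTrailingLeaves cs) ≡ false
endsWithLeaf-dropTrailingLeaves []       = refl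
endsWithLeaf-dropTrailingLeaves (c ∷ cs) with allUD (c ∷ cs) in e
... | true  = refl
... | false with dropTrailingLeaves cs in d | endsWithLeaf-dropTrailingLeaves cs
...   | _ ∷ _ | ih = ih
...   | []    | _  =
  trans (sym (∧-identityʳ (isUD c))) (trans (cong (isUD c ∧_) (sym (dropTrailingLeaves≡[]⇒allUD cs d))) e)

singleNonLeaf-drop-leaf∷ : ∀ ts → singleNonLeaf (dropTrailingLeaves (leaf ∷ ts)) ≡ false
singleNonLeaf-drop-leaf∷ ts with allUD ts | dropTrailingLeaves ts
... | true  | _     = refl
... | false | []    = refl
... | false | _ ∷ _ = refl

singleNonLeaf-drop-nonLeaf∷ : ∀ r rs ts → allUD ts ≡ false →
                              singleNonLeaf (dropTrailingLeaves (node (r ∷ rs) ∷ ts)) ≡ false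
singleNonLeaf-drop-nonLeaf∷ r rs ts e with dropTrailingLeaves ts in d
... | []    = trans (sym (dropTrailingLeaves≡[]⇒allUD ts d)) e
... | _ ∷ _ = refl

YF≡X-nest-Fᵗ : ∀ Q i → All YF≡Xᵖ Q → endsWithLeaf Q ≡ false → singleNonLeaf Q ≡ false →
               #DUDU+UUPDDᵖ (nest i (node (Fᵗ Q))) ≡ #DUD (Q ++ replicate i leaf)
YF≡X-nest-Fᵗ []       i _  _       _         = trans (Y-nest-leaf i) (sym (#DUD-leaves i))
YF≡X-nest-Fᵗ (q ∷ qs) i hs lastNonLeaf notSingle = begin
    #DUDU+UUPDDᵖ (nest i (node (Fprimᵗ q ∷ Fᵗ qs)))
  ≡⟨ Y-nest i (Fprimᵗ q) (Fᵗ qs) ⟩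
    i + (⟦ singleNonLeaf (Fᵗ (q ∷ qs)) ⟧ + y)
  ≡⟨ cong (λ b → i + (⟦ b ⟧ + y)) (trans (singleNonLeaf-Fᵗ (q ∷ qs)) notSingle) ⟩
    i + y
  ≡⟨ cong (i +_) (trans (cong (λ b → y + ⟦ b ⟧) (endsWithNonfirstLeaf⁻ (q ∷ qs) lastNonLeaf)) (+-identityʳ y)) ⟨
    i + (y + ⟦ endsWithNonfirstLeaf (q ∷ qs) ⟧)
  ≡⟨ cong (i +_) (YF≡X-forest (q ∷ qs) hs) ⟩
    i + #DUD (q ∷ qs)
  ≡⟨ +-comm i _ ⟩
    #DUD (q ∷ qs) + i
  ≡⟨ #DUD-++-leaves q qs i ⟨
    #DUD ((q ∷ qs) ++ replicate i leaf)
  ∎ where y = #DUDU+UUPDD (Fᵗ (q ∷ qs))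

YF≡X-nonPrimitiveQ : ∀ cs → All YF≡Xᵖ cs → singleNonLeaf (dropTrailingLeaves cs) ≡ false →
               #DUDU+UUPDDᵖ (nest (trailingUD cs) (node (FQᵗ cs))) ≡ #DUD cs
YF≡X-nonPrimitiveQ cs hs notSingle = begin
    #DUDU+UUPDDᵖ (nest (trailingUD cs) (node (FQᵗ cs)))
  ≡⟨ cong (λ Q → #DUDU+UUPDDᵖ (nest (trailingUD cs) (node Q))) (FQᵗ≡Fᵗ-dropTrailingLeaves cs) ⟩
    #DUDU+UUPDDᵖ (nest (trailingUD cs) (node (Fᵗ (dropTrailingLeaves cs))))
  ≡⟨ YF≡X-nest-Fᵗ (dropTrailingLeaves cs) (trailingUD cs) (All-dropTrailingLeaves cs hs)
                  (endsWithLeaf-dropTrailingLeaves cs) notSingle ⟩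
    #DUD (dropTrailingLeaves cs ++ replicate (trailingUD cs) leaf)
  ≡⟨ cong #DUD (dropTrailingLeaves-++ cs) ⟩
    #DUD cs
  ∎

YF≡X-primitiveQ : ∀ r rs ts → allUD ts ≡ true → All YF≡Xᵖ (r ∷ rs) →
  #DUDU+UUPDDᵖ (nest (length ts) (node (Fᵗ (r ∷ rs) ++ leaf ∷ []))) ≡ #DUD (node (r ∷ rs) ∷ ts)
YF≡X-primitiveQ r rs ts leaves hs = begin
    #DUDU+UUPDDᵖ (nest (length ts) (node (Fprimᵗ r ∷ Fᵗ rs ++ leaf ∷ [])))
  ≡⟨ Y-nest (length ts) (Fprimᵗ r) (Fᵗ rs ++ leaf ∷ []) ⟩
    length ts + (⟦ singleNonLeaf (Fprimᵗ r ∷ Fᵗ rs ++ leaf ∷ []) ⟧ + #DUDU+UUPDD (Fᵗ (r ∷ rs) ++ leaf ∷ []))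
  ≡⟨ cong (λ b → length ts + (⟦ b ⟧ + #DUDU+UUPDD (Fᵗ (r ∷ rs) ++ leaf ∷ []))) (singleNonLeaf-snocLeaf (Fprimᵗ r) (Fᵗ rs)) ⟩
    length ts + #DUDU+UUPDD (Fᵗ (r ∷ rs) ++ leaf ∷ [])
  ≡⟨ cong (length ts +_) (Y-snocLeaf (Fᵗ (r ∷ rs))) ⟩
    length ts + (#DUDU+UUPDD (Fᵗ (r ∷ rs)) + ⟦ endsWithNonfirstLeaf (Fᵗ (r ∷ rs)) ⟧)
  ≡⟨ cong (λ b → length ts + (#DUDU+UUPDD (Fᵗ (r ∷ rs)) + ⟦ b ⟧)) (endsWithNonfirstLeaf-Fᵗ (r ∷ rs)) ⟩
    length ts + (#DUDU+UUPDD (Fᵗ (r ∷ rs)) + ⟦ endsWithNonfirstLeaf (r ∷ rs) ⟧)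
  ≡⟨ cong (length ts +_) (YF≡X-forest (r ∷ rs) hs) ⟩
    length ts + #DUD (r ∷ rs)
  ≡⟨ cong (_+ #DUD (r ∷ rs)) (allLeaves-count ts leaves) ⟨
    ⟦ startsWithLeaf ts ⟧ + #DUD ts + #DUD (r ∷ rs)
  ≡⟨ solve 3 (λ h x a → h :+ x :+ a := a :+ h :+ x) refl ⟦ startsWithLeaf ts ⟧ (#DUD ts) (#DUD (r ∷ rs)) ⟩
    #DUD (r ∷ rs) + ⟦ startsWithLeaf ts ⟧ + #DUD ts
  ∎
  where
    singleNonLeaf-snocLeaf : ∀ x L → singleNonLeaf (x ∷ L ++ leaf ∷ []) ≡ false
    singleNonLeaf-snocLeaf _ []      = refl
    singleNonLeaf-snocLeaf _ (_ ∷ _) = refl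

YF≡X-nonLeafFirst : ∀ r rs ts → All YF≡Xᵖ (r ∷ rs) → All YF≡Xᵖ (node (r ∷ rs) ∷ ts) →
                    YF≡Xᵖ (node (node (r ∷ rs) ∷ ts))
YF≡X-nonLeafFirst r rs ts hR hcs with allUD ts in e
... | true  = YF≡X-primitiveQ r rs ts e hR
... | false = YF≡X-nonPrimitiveQ (node (r ∷ rs) ∷ ts) hcs (singleNonLeaf-drop-nonLeaf∷ r rs ts e)

mutual
  YF≡X-prim : ∀ p → YF≡Xᵖ p
  YF≡X-prim (node [])                        = YF≡X-nonPrimitiveQ [] [] refl
  YF≡X-prim (node cs@(node [] ∷ ts))         = YF≡X-nonPrimitiveQ cs (YF≡X-all cs) (singleNonLeaf-drop-leaf∷ ts)
  YF≡X-prim (node cs@(node (r ∷ rs) ∷ ts))   = YF≡X-nonLeafFirst r rs ts (YF≡X-all (r ∷ rs)) (YF≡X-all cs)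

  YF≡X-all : ∀ P → All YF≡Xᵖ P
  YF≡X-all []       = []
  YF≡X-all (p ∷ ps) = YF≡X-prim p ∷ YF≡X-all ps

endsWithLeaf≡endsWithNonfirstLeaf : ∀ P → 2 ≤ size P → endsWithLeaf P ≡ endsWithNonfirstLeaf P
endsWithLeaf≡endsWithNonfirstLeaf (node (_ ∷ _) ∷ []) _ = refl
endsWithLeaf≡endsWithNonfirstLeaf (_ ∷ _ ∷ _)         _ = refl
endsWithLeaf≡endsWithNonfirstLeaf (node [] ∷ [])      (s≤s ())

proposition12 : (n : ℕ) → 2 ≤ n → (P : DyckPath) → size P ≡ n → Y (F P) ≡ X (word P)
proposition12 .(size P) 2≤n P refl = begin
    Y (F P)
  ≡⟨ cong Y (word-Fᵗ P) ⟨
    Y (word (Fᵗ P))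
  ≡⟨ Y-word (Fᵗ P) ⟩
    #DUDU+UUPDD (Fᵗ P) + ⟦ endsWithLeaf (Fᵗ P) ⟧
  ≡⟨ cong (λ b → #DUDU+UUPDD (Fᵗ P) + ⟦ b ⟧)
          (trans (endsWithLeaf-Fᵗ P) (endsWithLeaf≡endsWithNonfirstLeaf P 2≤n)) ⟩
    #DUDU+UUPDD (Fᵗ P) + ⟦ endsWithNonfirstLeaf P ⟧
  ≡⟨ YF≡X-forest P (YF≡X-all P) ⟩
    #DUD P
  ≡⟨ X-word P ⟨
    X (word P)
  ∎
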